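{- Let $k\geq 1$ be an integer and let $G$ be a uniquely $(k+1)$-colorable graph with chromatic number $k+1$. Let $c$ be its unique $(k+1)$-coloring, with color classes labeled $C_1,\ldots,C_{k+1}$. If $|C_i|\geq i-1$ for each $i\leq k+1$, then $G$ is uniquely $k$-list colorable.
   Context: All graphs are finite, simple and undirected. A graph is uniquely $m$-colorable if it has exactly one proper $m$-coloring up to permutation of the colors. A $k$-list assignment $L$ to a graph $G$ assigns to each vertex $v$ a set $L(v)$ of exactly $k$ colors; an $L$-coloring is a proper coloring $c$ with $c(v)\in L(v)$ for all $v$. $G$ is uniquely $k$-list colorable if there exists a $k$-list assignment $L$ such that $G$ has exactly one $L$-coloring. -}

module Defs where

open import Data.Nat using (ℕ; _≤_)
open import Data.Fin using (Fin; toℕ; _≟_)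
open import Data.Bool using (Bool; true; false)
open import Data.List using (List; length; filter; allFin)
open import Data.List.Membership.Propositional using (_∈_)
open import Data.List.Relation.Unary.Unique.Propositional using (Unique)
open import Data.Product using (Σ; ∃; _×_; _,_; proj₁; proj₂)
open import Function.Bundles using (_↔_; Inverse)
open import Relation.Binary.PropositionalEquality using (_≡_; _≢_)
open import Relation.Nullary using (¬_)

record Graph : Set where
  field
    n      : ℕ
    adj    : Fin n → Fin n → Bool
    sym    : ∀ u v → adj u v ≡ adj v u
    irrefl : ∀ v → adj v v ≡ false

open Graph public

Proper : (G : Graph) {C : Set} → (Fin (n G) → C) → Set
Proper G c = ∀ u v → adj G u v ≡ true → c u ≢ c v

Coloring : Graph → ℕ → Set
Coloring G m = Σ (Fin (n G) → Fin m) (Proper G)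

UniquelyColorable : Graph → ℕ → Set
UniquelyColorable G m =
  Coloring G m ×
  ((c c' : Coloring G m) →
     Σ (Fin m ↔ Fin m) λ π → ∀ v → proj₁ c' v ≡ Inverse.to π (proj₁ c v))

ChromaticNumber : Graph → ℕ → Set
ChromaticNumber G m = Coloring G m × (∀ j → j Data.Nat.< m → ¬ Coloring G j)
  where import Data.Nat

classSize : (G : Graph) {m : ℕ} → (Fin (n G) → Fin m) → Fin m → ℕ
classSize G c i = length (filter (λ v → c v ≟ i) (allFin (n G)))

ListAssignment : Graph → ℕ → Set
ListAssignment G k = Σ (Fin (n G) → List ℕ) λ L → ∀ v → Unique (L v) × length (L v) ≡ k

LColoring : (G : Graph) {k : ℕ} → ListAssignment G k → (Fin (n G) → ℕ) → Set
LColoring G L f = Proper G f × (∀ v → f v ∈ proj₁ L v)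

UniquelyListColorable : Graph → ℕ → Set
UniquelyListColorable G k =
  Σ (ListAssignment G k) λ L →
    Σ (Fin (n G) → ℕ) λ f → LColoring G L f ×
      (∀ g → LColoring G L g → ∀ v → g v ≡ f v)

{-# OPTIONS --safe #-}
module Submission where

-- Number the colours 0, …, k, so that class j has at least j vertices. The r-th vertex
-- of class j (from 0, r < j) gets every colour except r; every other vertex loses some colour
-- other than its own, which exists as k ≥ 1. Then c is an L-colouring, and any
-- L-colouring is π ∘ c for a permutation π, by unique colourability. If π j < j, the
-- (π j)-th vertex of class j would receive its forbidden colour; so π is inflationary,
-- and an inflationary injection of Fin (k + 1) is the identity.

open import Defs
open import Data.Nat using (ℕ; suc; _≤_)
open import Data.Fin using (Fin; toℕ)
open import Data.Product using (Σ; _×_; proj₁)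

open import Data.Nat using (zero; _<_; _<?_; s≤s)
open import Data.Nat.Properties using (<-irrefl; <-trans; <-≤-trans; ≮⇒≥)
open import Data.Fin using (zero; suc; fromℕ<; punchIn; punchOut; _≟_; _>_)
open import Data.Fin.Properties
  using ( toℕ<n; toℕ-injective; toℕ-fromℕ<; fromℕ<-toℕ; ≤∧≢⇒<
        ; punchInᵢ≢i; punchIn-punchOut; punchIn-injective)
open import Data.Fin.Induction using (>-wellFounded)
open import Data.Fin.Subset using (Subset; inside; outside; ∣_∣) renaming (_∈_ to _∈ₛ_)
open import Data.Bool using (true; false)
open import Data.Vec using (_∷_; here; there; tabulate)
open import Data.Vec.Properties using ([]=⇒lookup; lookup∘tabulate)
open import Data.List using (map; filter; length; allFin)
import Data.List as List
open import Data.List.Properties using (length-map; length-tabulate)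
open import Data.List.Membership.Propositional using (_∈_)
open import Data.List.Membership.Propositional.Properties using (∈-map⁺; ∈-map⁻; ∈-allFin)
open import Data.List.Relation.Unary.Unique.Propositional.Properties using (allFin⁺)
  renaming (map⁺ to Unique-map⁺)
open import Data.Product using (_,_; ∃; proj₂)
open import Function using (_∘_; id)
open import Function.Bundles using (Inverse; Injection)
open import Function.Definitions using (Injective)
open import Function.Properties.Inverse using (↔⇒↣)
open import Induction.WellFounded using (Acc; acc)
open import Relation.Binary.PropositionalEquality using (_≡_; _≢_; _≗_; refl; trans; cong; subst)
import Relation.Binary.PropositionalEquality as ≡
open import Relation.Nullary using (yes; no; does; contradiction)
open import Relation.Unary using (Pred; Decidable)
open import Level using (0ℓ)

rank : ∀ {n} → Subset n → Fin n → ℕ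
rank (_ ∷ _)       zero    = 0
rank (inside  ∷ p) (suc v) = suc (rank p v)
rank (outside ∷ p) (suc v) = rank p v

rank-surjective : ∀ {n} (p : Subset n) {r} → r < ∣ p ∣ → ∃ λ v → v ∈ₛ p × rank p v ≡ r
rank-surjective (inside ∷ p) {zero} _ = zero , here , refl
rank-surjective (inside ∷ p) {suc r} (s≤s r<∣p∣) with rank-surjective p r<∣p∣
... | v , v∈p , refl = suc v , there v∈p , refl
rank-surjective (outside ∷ p) r<∣p∣ with rank-surjective p r<∣p∣
... | v , v∈p , refl = suc v , there v∈p , refl

∣tabulate-does∣ : ∀ {n} {A : Set} {P : Pred A 0ℓ} (P? : Decidable P) (f : Fin n → A) →
  ∣ tabulate (does ∘ P? ∘ f) ∣ ≡ length (filter P? (List.tabulate f))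
∣tabulate-does∣ {zero}  P? f = refl
∣tabulate-does∣ {suc n} P? f with does (P? (f zero))
... | true  = cong suc (∣tabulate-does∣ P? (f ∘ suc))
... | false = ∣tabulate-does∣ P? (f ∘ suc)

colourClass : ∀ {n m} → (Fin n → Fin m) → Fin m → Subset n
colourClass c j = tabulate (λ v → does (c v ≟ j))

∣colourClass∣ : (G : Graph) {m : ℕ} (c : Fin (n G) → Fin m) (j : Fin m) →
  ∣ colourClass c j ∣ ≡ classSize G c j
∣colourClass∣ G c j = ∣tabulate-does∣ (λ v → c v ≟ j) id

∈-colourClass⇒ : ∀ {n m} {c : Fin n → Fin m} {j v} → v ∈ₛ colourClass c j → c v ≡ j
∈-colourClass⇒ {c = c} {j} {v} v∈
  with c v ≟ j | trans (≡.sym (lookup∘tabulate _ v)) ([]=⇒lookup v∈)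
... | yes cv≡j | _ = cv≡j
... | no _     | ()

inflationary∧injective⇒≗id : ∀ {n} (π : Fin n → Fin n) →
  (∀ j → toℕ j ≤ toℕ (π j)) → Injective _≡_ _≡_ π → π ≗ id
inflationary∧injective⇒≗id π inflationary injective j = go j (>-wellFounded j)
  where
  go : ∀ j → Acc _>_ j → π j ≡ j
  go j (acc above) with π j ≟ j
  ... | yes πj≡j = πj≡j
  ... | no  πj≢j = injective (go (π j) (above (≤∧≢⇒< (inflationary j) (πj≢j ∘ ≡.sym))))

avoiding : ∀ {k} (G : Graph) → (Fin (n G) → Fin (suc k)) → ListAssignment G k
avoiding {k} G forbid = lists , λ v → Unique-map⁺ (toℕ-punchIn-injective v) (allFin⁺ k)
                                     , trans (length-map _ (allFin k)) (length-tabulate id)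
  where
  lists : Fin (n G) → List.List ℕ
  lists v = map (toℕ ∘ punchIn (forbid v)) (allFin k)
  toℕ-punchIn-injective : ∀ v → Injective _≡_ _≡_ (toℕ ∘ punchIn (forbid v))
  toℕ-punchIn-injective v = punchIn-injective (forbid v) _ _ ∘ toℕ-injective

∈-avoiding⁺ : ∀ {k} (G : Graph) {forbid : Fin (n G) → Fin (suc k)} {v w} →
  forbid v ≢ w → toℕ w ∈ proj₁ (avoiding G forbid) v
∈-avoiding⁺ G {forbid} {v} {w} forbid≢w =
  subst (λ u → toℕ u ∈ proj₁ (avoiding G forbid) v) (punchIn-punchOut forbid≢w)
        (∈-map⁺ (toℕ ∘ punchIn (forbid v)) (∈-allFin (punchOut forbid≢w)))

avoiding-LColoring⇒Coloring : ∀ {k} (G : Graph) {forbid : Fin (n G) → Fin (suc k)} {g} →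
  LColoring G (avoiding G forbid) g →
  ∃ λ (c : Fin (n G) → Fin (suc k)) →
    Proper G c × (∀ v → forbid v ≢ c v) × (∀ v → g v ≡ toℕ (c v))
avoiding-LColoring⇒Coloring G {forbid} {g} (g-proper , g∈L) = c , c-proper , forbid≢c , g≡c
  where
  slot : ∀ v → Fin _
  slot v = proj₁ (∈-map⁻ (toℕ ∘ punchIn (forbid v)) (g∈L v))
  c : Fin (n G) → Fin _
  c v = punchIn (forbid v) (slot v)
  forbid≢c : ∀ v → forbid v ≢ c v
  forbid≢c v = punchInᵢ≢i (forbid v) (slot v) ∘ ≡.sym
  g≡c : ∀ v → g v ≡ toℕ (c v)
  g≡c v = proj₂ (proj₂ (∈-map⁻ (toℕ ∘ punchIn (forbid v)) (g∈L v)))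
  c-proper : Proper G c
  c-proper u v u~v cu≡cv =
    g-proper u v u~v (trans (g≡c u) (trans (cong toℕ cu≡cv) (≡.sym (g≡c v))))

uniquelyListColorable-avoiding : ∀ {k} (G : Graph) → UniquelyColorable G (suc k) →
  (c : Fin (n G) → Fin (suc k)) → Proper G c →
  (forbid : Fin (n G) → Fin (suc k)) → (∀ v → forbid v ≢ c v) →
  (∀ j x → toℕ x < toℕ j → ∃ λ v → c v ≡ j × forbid v ≡ x) →
  UniquelyListColorable G k
uniquelyListColorable-avoiding G (_ , unique) c c-proper forbid forbid≢c forbid-onto =
  avoiding G forbid , toℕ ∘ c , (toℕ∘c-proper , c∈L) , only
  where
  toℕ∘c-proper : Proper G (toℕ ∘ c)
  toℕ∘c-proper u v u~v = c-proper u v u~v ∘ toℕ-injective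

  c∈L : ∀ v → toℕ (c v) ∈ proj₁ (avoiding G forbid) v
  c∈L v = ∈-avoiding⁺ G {forbid} (forbid≢c v)

  avoiding-colouring-unique :
    (c′ : Fin (n G) → Fin _) → Proper G c′ → (∀ v → forbid v ≢ c′ v) → c′ ≗ c
  avoiding-colouring-unique c′ c′-proper forbid≢c′
    with unique (c , c-proper) (c′ , c′-proper)
  ... | π↔ , c′≡π∘c =
    λ v → trans (c′≡π∘c v) (inflationary∧injective⇒≗id π π-inflationary π-injective (c v))
    where
    π : Fin _ → Fin _
    π = Inverse.to π↔
    π-injective : Injective _≡_ _≡_ π
    π-injective = Injection.injective (↔⇒↣ π↔)
    π-inflationary : ∀ j → toℕ j ≤ toℕ (π j)
    π-inflationary j with toℕ (π j) <? toℕ j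
    ... | no πj≮j = ≮⇒≥ πj≮j
    ... | yes πj<j with forbid-onto j (π j) πj<j
    ...   | u , refl , forbid-u≡πj =
      contradiction (trans forbid-u≡πj (≡.sym (c′≡π∘c u))) (forbid≢c′ u)

  only : ∀ g → LColoring G (avoiding G forbid) g → ∀ v → g v ≡ toℕ (c v)
  only g g-LColoring v with avoiding-LColoring⇒Coloring G g-LColoring
  ... | c′ , c′-proper , forbid≢c′ , g≡c′ =
    trans (g≡c′ v) (cong toℕ (avoiding-colouring-unique c′ c′-proper forbid≢c′ v))

forbiddenColour : ∀ {k} → Fin (suc (suc k)) → ℕ → Fin (suc (suc k))
forbiddenColour j r with r <? toℕ j
... | yes r<j = fromℕ< (<-trans r<j (toℕ<n j))
... | no  _   = punchIn j zero

forbiddenColour≢ : ∀ {k} (j : Fin (suc (suc k))) r → forbiddenColour j r ≢ j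
forbiddenColour≢ j r with r <? toℕ j
... | yes r<j = λ eq → <-irrefl (trans (≡.sym (toℕ-fromℕ< _)) (cong toℕ eq)) r<j
... | no  _   = punchInᵢ≢i j zero

forbiddenColour-below : ∀ {k} (j x : Fin (suc (suc k))) → toℕ x < toℕ j →
  forbiddenColour j (toℕ x) ≡ x
forbiddenColour-below j x x<j with toℕ x <? toℕ j
... | yes _   = fromℕ<-toℕ x _
... | no  x≮j = contradiction x<j x≮j

module RankForbidding {n k} (c : Fin n → Fin (suc (suc k))) where

  forbid : Fin n → Fin (suc (suc k))
  forbid v = forbiddenColour (c v) (rank (colourClass c (c v)) v)

  forbid≢c : ∀ v → forbid v ≢ c v
  forbid≢c v = forbiddenColour≢ (c v) _

  forbid-onto : (∀ i → toℕ i ≤ ∣ colourClass c i ∣) →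
    ∀ j x → toℕ x < toℕ j → ∃ λ v → c v ≡ j × forbid v ≡ x
  forbid-onto large j x x<j with rank-surjective (colourClass c j) (<-≤-trans x<j (large j))
  ... | v , v∈Cj , rank≡x with ∈-colourClass⇒ {c = c} v∈Cj
  ... | refl =
    v , refl , trans (cong (forbiddenColour (c v)) rank≡x) (forbiddenColour-below (c v) x x<j)

lemma1 : (k : ℕ) → 1 ≤ k → (G : Graph) →
    UniquelyColorable G (suc k) → ChromaticNumber G (suc k) →
    (c : Coloring G (suc k)) →
    (∀ (i : Fin (suc k)) → toℕ i ≤ classSize G (proj₁ c) i) →
    UniquelyListColorable G k
-- Unique colourability alone suffices.
lemma1 (suc k) _ G unique _ (c , c-proper) classSizes =
  uniquelyListColorable-avoiding G unique c c-proper forbid forbid≢c (forbid-onto large)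
  where
  open RankForbidding c
  large : ∀ i → toℕ i ≤ ∣ colourClass c i ∣
  large i = subst (toℕ i ≤_) (≡.sym (∣colourClass∣ G c i)) (classSizes i)
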